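{- Let $\Omega$ be a $D$-set, $A\subseteq\Omega$, $\mathcal{C}$ a splitting of $\Omega$, and let $\mathcal{C}(A)$ denote the union of those sectors of $\mathcal{C}$ which contain elements of $A$. Then all elements of $\Omega\setminus\mathcal{C}(A)$ have the same quantifier-free type over $A$ (in the language $\{D\}$).
   Context: A $D$-set is a set $\Omega$ with a quaternary relation $D$, written $D(wx;yz)$, such that for all $w,x,y,z\in\Omega$: (D1) $D(wx;yz)\to (D(xw;yz)\wedge D(yz;wx))$; (D2) $D(wx;yz)\to\neg D(wy;xz)$; (D3) $D(wx;yz)\to\forall v\,(D(vx;yz)\vee D(wx;yv))$; (D4) $(w\neq y\wedge x\neq y)\to D(wx;yy)$. A splitting of $\Omega$ is a partition of $\Omega$ into at least two parts (sectors) such that (i) if $a,b$ lie in a part $\Sigma$ and $c,d\in\Omega\setminus\Sigma$ then $D(ab;cd)$, and (ii) if $a,b,c,d$ lie in four distinct parts then $\neg D(ab;cd)$. -}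

module Defs where

open import Data.Empty using (⊥)
open import Data.Product using (Σ; ∃; ∃-syntax; _×_)
open import Data.Sum using (_⊎_)
open import Relation.Nullary using (¬_)
open import Relation.Binary.PropositionalEquality using (_≡_; _≢_)
open import Function.Bundles using (_⇔_)

-- A D-set: a set Ω with a quaternary relation D, D w x y z read as D(wx;yz).
record IsDSet (Ω : Set) (D : Ω → Ω → Ω → Ω → Set) : Set where
  field
    D1 : ∀ {w x y z} → D w x y z → D x w y z × D y z w x
    D2 : ∀ {w x y z} → D w x y z → ¬ D w y x z
    D3 : ∀ {w x y z} → D w x y z → ∀ v → D v x y z ⊎ D w x y v
    D4 : ∀ {w x y} → w ≢ y → x ≢ y → D w x y y

Subset : Set → Set₁
Subset Ω = Ω → Set

-- A splitting of Ω: a partition of Ω into sectors, given as the fibres of a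
-- map sec : Ω → I (two elements lie in the same sector iff sec agrees on them).
-- The sectors are exactly the nonempty fibres.
record IsSplitting {Ω : Set} (D : Ω → Ω → Ω → Ω → Set) {I : Set} (sec : Ω → I) : Set where
  field
    twoParts : ∃[ p ] ∃[ q ] sec p ≢ sec q
    split-i  : ∀ {a b c d} → sec a ≡ sec b → sec c ≢ sec a → sec d ≢ sec a → D a b c d
    split-ii : ∀ {a b c d} →
               sec a ≢ sec b → sec a ≢ sec c → sec a ≢ sec d →
               sec b ≢ sec c → sec b ≢ sec d → sec c ≢ sec d →
               ¬ D a b c d

CA : {Ω I : Set} → (Ω → I) → Subset Ω → Subset Ω
CA sec A x = ∃[ a ] (A a × sec a ≡ sec x)

data Term {Ω : Set} (A : Subset Ω) : Set where
  var : Term A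
  par : (a : Ω) → A a → Term A

data QFFormula {Ω : Set} (A : Subset Ω) : Set where
  atomD  : Term A → Term A → Term A → Term A → QFFormula A
  atomEq : Term A → Term A → QFFormula A
  falsum : QFFormula A
  neg    : QFFormula A → QFFormula A
  conj   : QFFormula A → QFFormula A → QFFormula A
  disj   : QFFormula A → QFFormula A → QFFormula A
  impl   : QFFormula A → QFFormula A → QFFormula A

evalT : {Ω : Set} {A : Subset Ω} → Ω → Term A → Ω
evalT x var       = x
evalT x (par a _) = a

Sat : {Ω : Set} (D : Ω → Ω → Ω → Ω → Set) {A : Subset Ω} → Ω → QFFormula A → Set
Sat D x (atomD s t u w) = D (evalT x s) (evalT x t) (evalT x u) (evalT x w)
Sat D x (atomEq s t)    = evalT x s ≡ evalT x t
Sat D x falsum          = ⊥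
Sat D x (neg φ)         = ¬ Sat D x φ
Sat D x (conj φ ψ)      = Sat D x φ × Sat D x ψ
Sat D x (disj φ ψ)      = Sat D x φ ⊎ Sat D x ψ
Sat D x (impl φ ψ)      = Sat D x φ → Sat D x ψ

SameQFType : {Ω : Set} (D : Ω → Ω → Ω → Ω → Set) (A : Subset Ω) → Ω → Ω → Set
SameQFType D A x y = (φ : QFFormula A) → Sat D x φ ⇔ Sat D y φ

-- A parameter a ∈ A lies in a sector different from
-- the sectors of x and y, so x and y are distinct from every parameter and an
-- atomic formula with at least two occurrences of the variable has a truth value
-- forced by the D-set axioms alone (D4 and D2). With one occurrence of the
-- variable, D(xa;bc) implies D(ya;bc) by D3, because the alternative D(xa;by)
-- is refuted by the splitting: either x, y share a sector, or a, b do, or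
-- x, a, b, y lie in four distinct sectors. Classical logic is used only to
-- decide equality of sectors.
module Submission where

open import Defs
open import Axiom.ExcludedMiddle using (ExcludedMiddle)
open import Level using (0ℓ)
open import Relation.Nullary using (¬_; yes; no)
open import Data.Empty using (⊥-elim)
open import Data.Product using (_×_; _,_; proj₁; proj₂)
open import Data.Product.Function.NonDependent.Propositional using (_×-⇔_)
open import Data.Sum using (inj₁; inj₂)
open import Data.Sum.Function.Propositional using (_⊎-⇔_)
open import Function.Bundles using (_⇔_; mk⇔)
open import Function.Construct.Identity using (⇔-id)
open import Function.Related.TypeIsomorphisms using (→-cong-⇔; ¬-cong-⇔)
open import Relation.Binary.PropositionalEquality using (_≡_; _≢_; refl; sym; cong; ≢-sym)

sameQFType-of-atoms : {Ω : Set} {D : Ω → Ω → Ω → Ω → Set} {A : Subset Ω} {x y : Ω} →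
  (∀ s t u w → Sat D x (atomD s t u w) ⇔ Sat D y (atomD s t u w)) →
  (∀ s t → Sat D x (atomEq s t) ⇔ Sat D y (atomEq s t)) →
  SameQFType D A x y
sameQFType-of-atoms {D = D} {A} {x} {y} atomD⇔ atomEq⇔ = go
  where
  go : SameQFType D A x y
  go (atomD s t u w) = atomD⇔ s t u w
  go (atomEq s t)    = atomEq⇔ s t
  go falsum          = ⇔-id _
  go (neg φ)         = ¬-cong-⇔ (go φ)
  go (conj φ ψ)      = go φ ×-⇔ go ψ
  go (disj φ ψ)      = go φ ⊎-⇔ go ψ
  go (impl φ ψ)      = →-cong-⇔ (go φ) (go ψ)

module DSetProperties {Ω : Set} {D : Ω → Ω → Ω → Ω → Set} (ds : IsDSet Ω D) where
  open IsDSet ds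

  D-swapˡ : ∀ {w x y z} → D w x y z → D x w y z
  D-swapˡ d = proj₁ (D1 d)

  D-swap-pairs : ∀ {w x y z} → D w x y z → D y z w x
  D-swap-pairs d = proj₂ (D1 d)

  D-swapʳ : ∀ {w x y z} → D w x y z → D w x z y
  D-swapʳ d = D-swap-pairs (D-swapˡ (D-swap-pairs d))

  ¬D-www : ∀ {w z} → ¬ D w w w z
  ¬D-www d = D2 d d

  D-ww : ∀ {w y z} → y ≢ w → z ≢ w → D w w y z
  D-ww y≢w z≢w = D-swap-pairs (D4 y≢w z≢w)

  ¬D-wxwz : ∀ {w x z} → x ≢ w → z ≢ w → ¬ D w x w z
  ¬D-wxwz x≢w z≢w = D2 (D-ww x≢w z≢w)

module SplittingProperties
  (em : ExcludedMiddle 0ℓ)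
  {Ω : Set} {D : Ω → Ω → Ω → Ω → Set} (ds : IsDSet Ω D)
  {I : Set} {sec : Ω → I} (sp : IsSplitting D sec) where
  open IsDSet ds
  open IsSplitting sp
  open DSetProperties ds

  SectorApart : Ω → Ω → Ω → Set
  SectorApart x y p = sec p ≢ sec x × sec p ≢ sec y

  ≢-of-apartˡ : ∀ {x y p} → SectorApart x y p → p ≢ x
  ≢-of-apartˡ (p≁x , _) e = p≁x (cong sec e)

  ≢-of-apartʳ : ∀ {x y p} → SectorApart x y p → p ≢ y
  ≢-of-apartʳ (_ , p≁y) e = p≁y (cong sec e)

  ¬D-across : ∀ {x y a b} → SectorApart x y a → SectorApart x y b → ¬ D x a b y
  ¬D-across {x} {y} {a} {b} (a≁x , a≁y) (b≁x , b≁y) d with em {sec x ≡ sec y}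
  ... | yes x∼y = D2 (split-i x∼y a≁x b≁x) (D-swapʳ d)
  ... | no x≁y with em {sec a ≡ sec b}
  ...   | yes a∼b = D2 (split-i a∼b (≢-sym a≁x) (≢-sym a≁y)) (D-swapˡ d)
  ...   | no a≁b = split-ii (≢-sym a≁x) (≢-sym b≁x) x≁y a≁b a≁y b≁y d

  D-replaceˡ : ∀ {x y a b c} → SectorApart x y a → SectorApart x y b →
               D x a b c → D y a b c
  D-replaceˡ a-apart b-apart d with D3 d _
  ... | inj₁ d′ = d′
  ... | inj₂ d′ = ⊥-elim (¬D-across a-apart b-apart d′)

  apart-of-∉CA : ∀ {A x y p} → ¬ CA sec A x → ¬ CA sec A y → A p → SectorApart x y p
  apart-of-∉CA {p = p} x∉CA y∉CA Ap = (λ e → x∉CA (p , Ap , e)) , (λ e → y∉CA (p , Ap , e))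

  module AtomTransfer {A : Subset Ω} {x y : Ω} (apart : ∀ {p} → A p → SectorApart x y p) where
    private
      ≢x : ∀ {p} → A p → p ≢ x
      ≢x Ap = ≢-of-apartˡ (apart Ap)

      ≢y : ∀ {p} → A p → p ≢ y
      ≢y Ap = ≢-of-apartʳ (apart Ap)

      replace : ∀ {a b c} → A a → A b → D x a b c → D y a b c
      replace Aa Ab = D-replaceˡ (apart Aa) (apart Ab)

    atomD-transfer : ∀ s t u w → Sat D x (atomD s t u w) → Sat D y (atomD s t u w)
    atomD-transfer (par _ _)  (par _ _)  (par _ _)  (par _ _)  d = d
    atomD-transfer var        (par _ Aa) (par _ Ab) (par _ _)  d = replace Aa Ab d
    atomD-transfer (par _ Aa) var        (par _ Ab) (par _ _)  d = D-swapˡ (replace Aa Ab (D-swapˡ d))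
    atomD-transfer (par _ Aa) (par _ _)  var        (par _ Ac) d =
      D-swap-pairs (replace Ac Aa (D-swap-pairs d))
    atomD-transfer (par _ Aa) (par _ _)  (par _ Ac) var        d =
      D-swap-pairs (D-swapˡ (replace Ac Aa (D-swapˡ (D-swap-pairs d))))
    atomD-transfer var        var        (par _ Aa) (par _ Ab) _ = D-ww (≢y Aa) (≢y Ab)
    atomD-transfer (par _ Aa) (par _ Ab) var        var        _ = D-swap-pairs (D-ww (≢y Aa) (≢y Ab))
    atomD-transfer var        (par _ Aa) var        (par _ Ab) d = ⊥-elim (¬D-wxwz (≢x Aa) (≢x Ab) d)
    atomD-transfer var        (par _ Aa) (par _ Ab) var        d =
      ⊥-elim (¬D-wxwz (≢x Aa) (≢x Ab) (D-swapʳ d))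
    atomD-transfer (par _ Aa) var        var        (par _ Ab) d =
      ⊥-elim (¬D-wxwz (≢x Aa) (≢x Ab) (D-swapˡ d))
    atomD-transfer (par _ Aa) var        (par _ Ab) var        d =
      ⊥-elim (¬D-wxwz (≢x Aa) (≢x Ab) (D-swapʳ (D-swapˡ d)))
    atomD-transfer var        var        var        (par _ _)  d = ⊥-elim (¬D-www d)
    atomD-transfer var        var        (par _ _)  var        d = ⊥-elim (¬D-www (D-swapʳ d))
    atomD-transfer var        (par _ _)  var        var        d = ⊥-elim (¬D-www (D-swap-pairs d))
    atomD-transfer (par _ _)  var        var        var        d = ⊥-elim (¬D-www (D-swapʳ (D-swap-pairs d)))
    atomD-transfer var        var        var        var        d = ⊥-elim (¬D-www d)

    atomEq-transfer : ∀ s t → Sat D x (atomEq s t) → Sat D y (atomEq s t)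
    atomEq-transfer var        var        _ = refl
    atomEq-transfer var        (par _ Aa) e = ⊥-elim (≢x Aa (sym e))
    atomEq-transfer (par _ Aa) var        e = ⊥-elim (≢x Aa e)
    atomEq-transfer (par _ _)  (par _ _)  e = e

mainTheorem8 : ExcludedMiddle 0ℓ →
    (Ω : Set) (D : Ω → Ω → Ω → Ω → Set) → IsDSet Ω D →
    (A : Subset Ω) →
    (I : Set) (sec : Ω → I) → IsSplitting D sec →
    (x y : Ω) → ¬ CA sec A x → ¬ CA sec A y →
    SameQFType D A x y
mainTheorem8 em Ω D ds A I sec sp x y x∉CA y∉CA =
  sameQFType-of-atoms
    (λ s t u w → mk⇔ (xy.atomD-transfer s t u w) (yx.atomD-transfer s t u w))
    (λ s t → mk⇔ (xy.atomEq-transfer s t) (yx.atomEq-transfer s t))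
  where
  open SplittingProperties em ds sp
  module xy = AtomTransfer (apart-of-∉CA x∉CA y∉CA)
  module yx = AtomTransfer (apart-of-∉CA y∉CA x∉CA)
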